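{- Let $G$ be a graph with no induced subgraph that is a $(4,\xi)$-reducible subgraph of $G$, where $\xi=2^{ -48}$. Let $u,v\in V(G)$ be distinct stressed vertices such that $N(u)\cap N(v)$ contains two distinct vertices $r_1,r_2$ of degree $3$. Then $G[\{u,v,r_1,r_2\}]$ is a special $K_4$.
   Context: All graphs are finite and simple; degrees are in $G$. For $f:V(H)\to\mathbb Z$, an $f$-assignment on $H$ assigns each $v$ a set $L(v)\subseteq\mathbb N$ with $|L(v)|=\max\{0,f(v)\}$; an $L$-coloring is a proper coloring $\phi$ with $\phi(v)\in L(v)$. For an induced subgraph $H$ of $G$, let $\ell_H(v)=4-\deg_G(v)+\deg_H(v)$. $H$ is a $(4,\xi)$-reducible subgraph of $G$ if for every $\ell_H$-assignment $L$ on $H$ there is a probability distribution on $L$-colorings $\phi$ of $H$ with (FIX) $\Pr(\phi(v)=c)\ge\xi$ for all $v\in V(H)$, $c\in L(v)$; (FORB) for all $U\subseteq V(H)$ with $|U|\le2$ and $c\in\bigcup_{u\in U}L(u)$, $\Pr(\phi(u)\ne c\ \forall u\in U)\ge\xi$. A $d$-vertex is a vertex of degree $d$ in $G$; a $3$-neighbor of $u$ is a neighbor of degree $3$. A stressed vertex is a $4$-vertex with exactly two $3$-neighbors. A special $K_4$ is a subgraph isomorphic to $K_4$ containing exactly two $3$-vertices and two $4$-vertices. -}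

module Defs where

open import Data.Nat using (ℕ; _+_; _∸_; _^_; _≡ᵇ_)
open import Data.Fin using (Fin)
open import Data.Bool using (Bool; true; false; T; not; _∧_; if_then_else_)
open import Data.List using (List; []; _∷_; map; allFin; length; filter)
open import Data.Nat.ListAction using (sum)
open import Data.List.Membership.Propositional using (_∈_)
open import Data.List.Relation.Unary.All using (All)
open import Data.List.Relation.Unary.Unique.Propositional using (Unique)
open import Data.Integer using (+_)
open import Data.Rational using (ℚ; 0ℚ; 1ℚ; _/_; _≤_) renaming (_+_ to _+ℚ_)
open import Data.Product using (Σ; ∃; _×_; _,_)
open import Data.Sum using (_⊎_)
open import Relation.Nullary using (¬_)
open import Relation.Binary.PropositionalEquality using (_≡_; _≢_)

record Graph (n : ℕ) : Set where
  field
    adj    : Fin n → Fin n → Bool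
    sym    : ∀ x y → adj x y ≡ adj y x
    irrefl : ∀ x → adj x x ≡ false
open Graph public

Adj : ∀ {n} → Graph n → Fin n → Fin n → Set
Adj G x y = T (adj G x y)

count : ∀ {n} → (Fin n → Bool) → ℕ
count {n} f = sum (map (λ y → if f y then 1 else 0) (allFin n))

deg : ∀ {n} → Graph n → Fin n → ℕ
deg G x = count (adj G x)

-- An induced subgraph H of G is given by its vertex set VH : Fin n → Bool.
-- degree of x inside G[VH]
degH : ∀ {n} → Graph n → (Fin n → Bool) → Fin n → ℕ
degH G VH x = count (λ y → adj G x y ∧ VH y)

-- max{0, ℓ_H(v)} where ℓ_H(v) = 4 - deg_G(v) + deg_H(v)  (truncated subtraction on ℕ)
ell : ∀ {n} → Graph n → (Fin n → Bool) → Fin n → ℕ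
ell G VH v = (4 + degH G VH v) ∸ deg G v

-- an ℓ_H-assignment on H: each v ∈ V(H) gets a set of naturals (a duplicate-free list)
-- of size max{0, ℓ_H(v)}
IsAssignment : ∀ {n} → Graph n → (Fin n → Bool) → (Fin n → List ℕ) → Set
IsAssignment G VH L = ∀ v → T (VH v) → Unique (L v) × length (L v) ≡ ell G VH v

-- an L-coloring of H (values outside V(H) are irrelevant)
IsLColoring : ∀ {n} → Graph n → (Fin n → Bool) → (Fin n → List ℕ) → (Fin n → ℕ) → Set
IsLColoring G VH L φ =
  (∀ v → T (VH v) → φ v ∈ L v) ×
  (∀ x y → T (VH x) → T (VH y) → Adj G x y → φ x ≢ φ y)

-- finitely supported probability distributions with rational weights
Dist : ℕ → Set
Dist n = List ((Fin n → ℕ) × ℚ)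

weightSum : ∀ {n} → Dist n → ℚ
weightSum [] = 0ℚ
weightSum ((φ , w) ∷ D) = w +ℚ weightSum D

Pr : ∀ {n} → Dist n → ((Fin n → ℕ) → Bool) → ℚ
Pr [] E = 0ℚ
Pr ((φ , w) ∷ D) E = (if E φ then w else 0ℚ) +ℚ Pr D E

IsDistOnLColorings : ∀ {n} → Graph n → (Fin n → Bool) → (Fin n → List ℕ) → Dist n → Set
IsDistOnLColorings G VH L D =
  All (λ p → 0ℚ ≤ Data.Product.proj₂ p × IsLColoring G VH L (Data.Product.proj₁ p)) D ×
  weightSum D ≡ 1ℚ

FIX : ∀ {n} → (Fin n → Bool) → (Fin n → List ℕ) → ℚ → Dist n → Set
FIX VH L ξ D = ∀ v c → T (VH v) → c ∈ L v → ξ ≤ Pr D (λ φ → φ v ≡ᵇ c)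

-- (FORB): U ⊆ V(H) with |U| ≤ 2 is {u₁,u₂} (u₁ = u₂ allowed, giving singletons;
-- U = ∅ is vacuous since c must lie in the union of the lists)
FORB : ∀ {n} → (Fin n → Bool) → (Fin n → List ℕ) → ℚ → Dist n → Set
FORB VH L ξ D = ∀ u₁ u₂ c → T (VH u₁) → T (VH u₂) → (c ∈ L u₁ ⊎ c ∈ L u₂) →
  ξ ≤ Pr D (λ φ → not (φ u₁ ≡ᵇ c) ∧ not (φ u₂ ≡ᵇ c))

Reducible4 : ∀ {n} → ℚ → Graph n → (Fin n → Bool) → Set
Reducible4 {n} ξ G VH = ∀ L → IsAssignment G VH L →
  Σ (Dist n) λ D → IsDistOnLColorings G VH L D × FIX VH L ξ D × FORB VH L ξ D

ξ₀ : ℚ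
ξ₀ = + 1 / (2 ^ 48)

NoReducible : ∀ {n} → ℚ → Graph n → Set
NoReducible ξ G = ∀ VH → (∃ λ v → T (VH v)) → ¬ Reducible4 ξ G VH

Stressed : ∀ {n} → Graph n → Fin n → Set
Stressed G u = deg G u ≡ 4 × count (λ y → adj G u y ∧ (deg G y ≡ᵇ 3)) ≡ 2

countDeg : ∀ {n} → Graph n → ℕ → List (Fin n) → ℕ
countDeg G d xs = length (filter (λ x → T? (deg G x ≡ᵇ d)) xs)
  where open import Data.Bool using (T?)

-- G[{a,b,c,d}] is a special K4: isomorphic to K4 (all six pairs adjacent, hence
-- a,b,c,d distinct) with exactly two 3-vertices and two 4-vertices
SpecialK4 : ∀ {n} → Graph n → Fin n → Fin n → Fin n → Fin n → Set
SpecialK4 G a b c d =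
  (Adj G a b × Adj G a c × Adj G a d × Adj G b c × Adj G b d × Adj G c d) ×
  countDeg G 3 (a ∷ b ∷ c ∷ d ∷ []) ≡ 2 × countDeg G 4 (a ∷ b ∷ c ∷ d ∷ []) ≡ 2

-- Let H = G[{u, v, r₁, r₂}].  Since u, v are 4-vertices and r₁, r₂ are 3-vertices of G, every
-- ℓ_H-assignment gives u and v lists of size deg_H and r₁, r₂ lists of size deg_H + 1.  If one of
-- the chords uv, r₁r₂ is missing, H is a 4-cycle with at most one chord, and for each single
-- requirement of (FIX) or (FORB) some L-colouring of H meets it: greedily, except when r₁ and r₂
-- must both avoid a colour, where a short counting argument on the lists is needed.  The uniform
-- distribution on one such colouring per requirement (272 of them) then witnesses that H is
-- (4, 1/272)-reducible, and 1/272 ≥ 2⁻⁴⁸.  So both chords are present and H is a special K₄.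
module Submission where

open import Defs hiding (sym)
open import Data.Bool using (Bool; true; false; T; T?; not; _∧_; _∨_; if_then_else_)
open import Data.Bool.Properties using (∧-identityʳ; ∧-zeroʳ; ∧-distribˡ-∨; T-∧; T-≡)
open import Data.Empty using (⊥; ⊥-elim)
open import Data.Fin using (Fin; zero; suc)
import Data.Fin as Fin
import Data.Integer as ℤ
open import Data.List using (List; []; _∷_; _++_; length; map; allFin; cartesianProduct)
open import Data.List.Properties using (length-removeAt; length-removeAt′; map-cong)
open import Data.List.Membership.Propositional using (_∈_; _∉_; find; lose)
open import Data.List.Membership.Propositional.Properties
  using (∈-++⁺ˡ; ∈-++⁺ʳ; ∈-map⁺; ∈-allFin; ∈-cartesianProduct⁺)
import Data.List.Membership.DecPropositional as DecMembership
open import Data.List.Relation.Binary.Subset.Propositional using (_⊆_)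
import Data.List.Relation.Unary.All as All
open import Data.List.Relation.Unary.All using ([]; _∷_)
import Data.List.Relation.Unary.All.Properties as All
open import Data.List.Relation.Unary.AllPairs using ([]; _∷_)
open import Data.List.Relation.Unary.Any using (here; there; any?; index; _─_)
import Data.List.Relation.Unary.Any as Any
open import Data.List.Relation.Unary.Unique.Propositional using (Unique)
open import Data.List.Relation.Unary.Unique.Propositional.Properties using (allFin⁺)
open import Data.Nat using (ℕ; zero; suc; _≤_; _<_; z≤n; s≤s; _<ᵇ_; _≡ᵇ_; _+_)
import Data.Nat as ℕ
open import Data.Nat.ListAction using (sum)
open import Data.Nat.Properties
  using (≤-pred; ≤-refl; ≤-trans; ≤-reflexive; ≡ᵇ⇒≡; ≡⇒≡ᵇ; <ᵇ⇒<; <⇒≱; m≤n⇒m≤1+n; +-suc; +-identityʳ;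
         ∸-monoʳ-≤; m+n∸n≡m)
open import Data.Product using (Σ; ∃-syntax; _×_; _,_; proj₁; proj₂)
open import Data.Rational using (ℚ; 0ℚ; 1ℚ; _/_; +-0-rawMonoid) renaming (_≤_ to _≤ℚ_; _+_ to _+ℚ_)
import Data.Rational.Properties as ℚ
open import Algebra.Definitions.RawMonoid +-0-rawMonoid using () renaming (_×_ to _·_)
open import Data.Sum using (_⊎_; inj₁; inj₂)
open import Data.Unit using (⊤; tt)
open import Function using (_∘_; _$_)
open import Function.Bundles using (Equivalence)
open import Relation.Binary.Definitions using (DecidableEquality)
open import Relation.Binary.PropositionalEquality
  using (_≡_; _≢_; refl; sym; trans; cong; cong₂; subst; subst₂; ≢-sym; module ≡-Reasoning)
open import Relation.Nullary using (¬_; yes; no; Dec; ¬?; _×-dec_; decidable-stable)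
open import Relation.Nullary.Decidable using (does; dec-true; dec-false; toWitness)
open import Relation.Unary using (Decidable)

open DecMembership ℕ._≟_ using (_∈?_)

does-sound : ∀ {P : Set} (d : Dec P) → T (does d) → P
does-sound (yes p) _ = p

does-complete : ∀ {P : Set} (d : Dec P) → P → T (does d)
does-complete (yes _) _ = tt
does-complete (no ¬p) p = ¬p p

T⇒≡true : ∀ {b} → T b → b ≡ true
T⇒≡true = Equivalence.to T-≡

T-∧-intro : ∀ {x y} → T x → T y → T (x ∧ y)
T-∧-intro {true} _ Ty = Ty

≢⇒T-not-≡ᵇ : ∀ {m n} → m ≢ n → T (not (m ≡ᵇ n))
≢⇒T-not-≡ᵇ {m} {n} m≢n with m ≡ᵇ n in eq
... | true  = m≢n (≡ᵇ⇒≡ m n (subst T (sym eq) tt))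
... | false = tt

ind : Bool → ℕ
ind b = if b then 1 else 0

module _ {A : Set} where

  Avoids : A → List A → Set
  Avoids x []       = ⊤
  Avoids x (y ∷ ys) = x ≢ y × Avoids x ys

  ∉⇒Avoids : ∀ {x} ys → x ∉ ys → Avoids x ys
  ∉⇒Avoids []       x∉ = tt
  ∉⇒Avoids (y ∷ ys) x∉ = x∉ ∘ here , ∉⇒Avoids ys (x∉ ∘ there)

  Avoids⇒∉ : ∀ {x} ys → Avoids x ys → x ∉ ys
  Avoids⇒∉ (y ∷ ys) (x≢y , _)      (here x≡y) = x≢y x≡y
  Avoids⇒∉ (y ∷ ys) (_ , x-avoids) (there x∈) = Avoids⇒∉ ys x-avoids x∈

  ∈-─ : ∀ {w z : A} {xs} (p : w ∈ xs) → z ∈ xs → z ≢ w → z ∈ (xs ─ p)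
  ∈-─ (here refl) (here refl) z≢w = ⊥-elim (z≢w refl)
  ∈-─ (here refl) (there z∈)  _   = z∈
  ∈-─ (there p)   (here refl) _   = here refl
  ∈-─ (there p)   (there z∈)  z≢w = there (∈-─ p z∈ z≢w)

  ∈-∷-─ : ∀ {c w z : A} {xs ys} (p : w ∈ xs) → w ∉ ys → z ∈ c ∷ xs → z ∈ c ∷ ys → z ∈ c ∷ (xs ─ p)
  ∈-∷-─ p w∉ys (here z≡c)   _             = here z≡c
  ∈-∷-─ p w∉ys (there z∈xs) (here z≡c)    = here z≡c
  ∈-∷-─ p w∉ys (there z∈xs) (there z∈ys)  = there (∈-─ p z∈xs λ { refl → w∉ys z∈ys })

  pigeonhole : ∀ {xs ys : List A} → Unique xs → xs ⊆ ys → length xs ≤ length ys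
  pigeonhole {[]}     _              _     = z≤n
  pigeonhole {x ∷ xs} {ys} (x∉xs ∷ uniq) xs⊆ys =
    subst (suc (length xs) ≤_) (sym (length-removeAt′ ys (index x∈ys)))
      (s≤s (pigeonhole uniq λ z∈ → ∈-─ x∈ys (xs⊆ys (there z∈)) λ { refl → All.lookup x∉xs z∈ refl }))
    where x∈ys = xs⊆ys (here refl)

  ⊈-shorter : ∀ {xs F : List A} → Unique xs → length F < length xs → ¬ xs ⊆ F
  ⊈-shorter uniq short xs⊆F = <⇒≱ short (pigeonhole uniq xs⊆F)

  ⊈-both-triples : ∀ {xs : List A} {c α β α′ β′ w} → Unique xs → length xs ≡ 3 →
    (p : w ∈ α ∷ β ∷ []) → Avoids w (α′ ∷ β′ ∷ []) →
    xs ⊆ c ∷ α ∷ β ∷ [] → xs ⊆ c ∷ α′ ∷ β′ ∷ [] → ⊥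
  ⊈-both-triples {xs} {c} {α} {β} uniq three p w-avoids ⊆T ⊆T′ =
    ⊈-shorter uniq short λ z∈ → ∈-∷-─ p (Avoids⇒∉ _ w-avoids) (⊆T z∈) (⊆T′ z∈)
    where
    short : length (c ∷ (α ∷ β ∷ [] ─ p)) < length xs
    short = subst₂ _<_ (cong suc (sym (length-removeAt (α ∷ β ∷ []) (index p)))) (sym three) ≤-refl

  find-or-none : {P : A → Set} → Decidable P → ∀ xs → (∃[ x ] x ∈ xs × P x) ⊎ (∀ {x} → x ∈ xs → ¬ P x)
  find-or-none P? xs with any? P? xs
  ... | yes some = inj₁ (find some)
  ... | no none  = inj₂ λ x∈ px → none (lose x∈ px)

  module Fresh (_≟_ : DecidableEquality A) where
    open DecMembership _≟_ using () renaming (_∈?_ to _∈ᴬ?_)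

    fresh-or-⊆ : ∀ xs F → (∃[ x ] x ∈ xs × Avoids x F) ⊎ xs ⊆ F
    fresh-or-⊆ xs F with find-or-none (λ x → ¬? (x ∈ᴬ? F)) xs
    ... | inj₁ (x , x∈ , x∉) = inj₁ (x , x∈ , ∉⇒Avoids F x∉)
    ... | inj₂ none          = inj₂ λ {x} x∈ → decidable-stable (x ∈ᴬ? F) (none x∈)

    fresh-within : ∀ {xs} → Unique xs →
      ∀ F D → (∀ {z} → z ∈ xs → z ∈ F → z ∈ D) → length D < length xs → ∃[ x ] x ∈ xs × Avoids x F
    fresh-within {xs} uniq F D xs∩F⊆D short with fresh-or-⊆ xs F
    ... | inj₁ found = found
    ... | inj₂ xs⊆F  = ⊥-elim (⊈-shorter uniq short λ z∈ → xs∩F⊆D z∈ (xs⊆F z∈))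

    module _ {xs : List A} {k} (uniq : Unique xs) (len : length xs ≡ k) where

      fresh : ∀ F → T (length F <ᵇ k) → ∃[ x ] x ∈ xs × Avoids x F
      fresh F short = fresh-within uniq F F (λ _ z∈F → z∈F) (subst (length F <_) (sym len) (<ᵇ⇒< _ _ short))

      -- An entry w of F that is not in xs, or that occurs in F twice, does not count against xs.
      fresh-beside : ∀ F {w} (p : w ∈ F) → (w ∈ xs → w ∈ (F ─ p)) → T (length F <ᵇ suc k) →
        ∃[ x ] x ∈ xs × Avoids x F
      fresh-beside F {w} p w∈F─p short = fresh-within uniq F (F ─ p) within shorter
        where
        within : ∀ {z} → z ∈ xs → z ∈ F → z ∈ (F ─ p)
        within {z} z∈xs z∈F with z ≟ w
        ... | yes refl = w∈F─p z∈xs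
        ... | no z≢w   = ∈-─ p z∈F z≢w

        shorter : length (F ─ p) < length xs
        shorter = subst (length (F ─ p) <_) (sym len)
          (≤-pred (subst (λ m → suc m ≤ suc k) (length-removeAt′ F (index p)) (<ᵇ⇒< _ _ short)))

      too-many : ∀ {ys} → Unique ys → ys ⊆ xs → T (k <ᵇ length ys) → ⊥
      too-many {ys} uniq-ys ys⊆xs many =
        ⊈-shorter uniq-ys (subst (_< length ys) (sym len) (<ᵇ⇒< _ _ many)) ys⊆xs

open Fresh ℕ._≟_

-- The entry at position p, with junk value 0 past the end of the list.
nth : ∀ {m} → List ℕ → Fin m → ℕ
nth []       _       = 0
nth (x ∷ xs) zero    = x
nth (x ∷ xs) (suc p) = nth xs p

nth-index : ∀ {m c} xs → c ∈ xs → length xs ≤ m → ∃[ p ] nth {m} xs p ≡ c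
nth-index (x ∷ xs) (here refl) (s≤s _)   = zero , refl
nth-index (x ∷ xs) (there c∈)  (s≤s len) = let p , nth≡c = nth-index xs c∈ len in suc p , nth≡c

countIn : ∀ {A : Set} → (A → Bool) → List A → ℕ
countIn f xs = sum (map (λ y → ind (f y)) xs)

module _ {A : Set} where

  countIn-cong : ∀ {f g : A → Bool} → (∀ y → f y ≡ g y) → ∀ xs → countIn f xs ≡ countIn g xs
  countIn-cong f≗g xs = cong sum (map-cong (λ y → cong ind (f≗g y)) xs)

  countIn-∧-≤ : ∀ (f g : A → Bool) xs → countIn (λ y → f y ∧ g y) xs ≤ countIn f xs
  countIn-∧-≤ f g []       = z≤n
  countIn-∧-≤ f g (y ∷ ys) with f y | g y
  ... | true  | true  = s≤s (countIn-∧-≤ f g ys)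
  ... | true  | false = m≤n⇒m≤1+n (countIn-∧-≤ f g ys)
  ... | false | _     = countIn-∧-≤ f g ys

  countIn-∨ : ∀ (f g : A → Bool) → (∀ y → T (f y) → T (g y) → ⊥) →
    ∀ xs → countIn (λ y → f y ∨ g y) xs ≡ countIn f xs + countIn g xs
  countIn-∨ f g disjoint []       = refl
  countIn-∨ f g disjoint (y ∷ ys) with f y in fy | g y in gy
  ... | true  | true  = ⊥-elim (disjoint y (subst T (sym fy) tt) (subst T (sym gy) tt))
  ... | true  | false = cong suc (countIn-∨ f g disjoint ys)
  ... | false | true  = trans (cong suc (countIn-∨ f g disjoint ys)) (sym (+-suc (countIn f ys) (countIn g ys)))
  ... | false | false = countIn-∨ f g disjoint ys

  countIn-none : ∀ (f : A → Bool) xs → (∀ {y} → y ∈ xs → f y ≡ false) → countIn f xs ≡ 0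
  countIn-none f []       _     = refl
  countIn-none f (y ∷ ys) none rewrite none (here refl) = countIn-none f ys (none ∘ there)

  module _ (_≟_ : DecidableEquality A) where
    open DecMembership _≟_ using () renaming (_∈?_ to _∈ᴬ?_)

    countIn-≟ : ∀ (f : A → Bool) {s} xs → Unique xs → s ∈ xs → countIn (λ y → f y ∧ does (y ≟ s)) xs ≡ ind (f s)
    countIn-≟ f (x ∷ xs) (x∉xs ∷ _) (here refl)
      rewrite dec-true (x ≟ x) refl | ∧-identityʳ (f x) =
        trans (cong (ind (f x) +_) (countIn-none _ xs others)) (+-identityʳ (ind (f x)))
      where
      others : ∀ {y} → y ∈ xs → f y ∧ does (y ≟ x) ≡ false
      others {y} y∈ rewrite dec-false (y ≟ x) (≢-sym (All.lookup x∉xs y∈)) = ∧-zeroʳ (f y)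
    countIn-≟ f (x ∷ xs) (x∉xs ∷ uniq) (there s∈)
      rewrite dec-false (x ≟ _) (All.lookup x∉xs s∈) | ∧-zeroʳ (f x) = countIn-≟ f xs uniq s∈

    countIn-∧-∈ : ∀ (f : A → Bool) S → Unique S → ∀ xs → Unique xs → S ⊆ xs →
      countIn (λ y → f y ∧ does (y ∈ᴬ? S)) xs ≡ sum (map (λ s → ind (f s)) S)
    countIn-∧-∈ f [] _ xs _ _ = countIn-none _ xs λ {y} _ → ∧-zeroʳ (f y)
    countIn-∧-∈ f (s ∷ S) (s∉S ∷ uniqS) xs uniq S⊆xs = begin
      countIn (λ y → f y ∧ (does (y ≟ s) ∨ does (y ∈ᴬ? S))) xs
        ≡⟨ countIn-cong (λ y → ∧-distribˡ-∨ (f y) _ _) xs ⟩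
      countIn (λ y → (f y ∧ does (y ≟ s)) ∨ (f y ∧ does (y ∈ᴬ? S))) xs
        ≡⟨ countIn-∨ _ _ disjoint xs ⟩
      countIn (λ y → f y ∧ does (y ≟ s)) xs + countIn (λ y → f y ∧ does (y ∈ᴬ? S)) xs
        ≡⟨ cong₂ _+_ (countIn-≟ f xs uniq (S⊆xs (here refl)))
                     (countIn-∧-∈ f S uniqS xs uniq (S⊆xs ∘ there)) ⟩
      ind (f s) + sum (map (λ s → ind (f s)) S) ∎
      where
      open ≡-Reasoning
      disjoint : ∀ y → T (f y ∧ does (y ≟ s)) → T (f y ∧ does (y ∈ᴬ? S)) → ⊥
      disjoint y y≡s y∈S with does-sound (y ≟ s) (proj₂ (Equivalence.to T-∧ y≡s))
      ... | refl = All.lookup s∉S (does-sound (y ∈ᴬ? S) (proj₂ (Equivalence.to T-∧ y∈S))) refl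

degH≤deg : ∀ {n} (G : Graph n) VH x → degH G VH x ≤ deg G x
degH≤deg {n} G VH x = countIn-∧-≤ (adj G x) VH (allFin n)

ell≤4 : ∀ {n} (G : Graph n) VH x → ell G VH x ≤ 4
ell≤4 G VH x = ≤-trans (∸-monoʳ-≤ (4 + degH G VH x) (degH≤deg G VH x)) (≤-reflexive (m+n∸n≡m 4 (degH G VH x)))

Adj-irrefl : ∀ {n} (G : Graph n) {x y} → Adj G x y → x ≢ y
Adj-irrefl G {x} xy refl = subst T (irrefl G x) xy

Adj-sym : ∀ {n} (G : Graph n) {x y} → Adj G x y → Adj G y x
Adj-sym G {x} {y} = subst T (Graph.sym G x y)

uniform : ∀ {n} {A : Set} → (A → Fin n → ℕ) → ℚ → List A → Dist n
uniform g w = map (λ a → g a , w)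

weightSum-uniform : ∀ {n} {A : Set} (g : A → Fin n → ℕ) w as → weightSum (uniform g w as) ≡ length as · w
weightSum-uniform g w []       = refl
weightSum-uniform g w (a ∷ as) = cong (w +ℚ_) (weightSum-uniform g w as)

module _ {n} {A : Set} (g : A → Fin n → ℕ) {w : ℚ} (0≤w : 0ℚ ≤ℚ w) (E : (Fin n → ℕ) → Bool) where

  private
    weight-≥0 : ∀ b → 0ℚ ≤ℚ (if b then w else 0ℚ)
    weight-≥0 true  = 0≤w
    weight-≥0 false = ℚ.≤-refl

  Pr-uniform-≥0 : ∀ as → 0ℚ ≤ℚ Pr (uniform g w as) E
  Pr-uniform-≥0 []       = ℚ.≤-refl
  Pr-uniform-≥0 (a ∷ as) = ℚ.+-mono-≤ (weight-≥0 (E (g a))) (Pr-uniform-≥0 as)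

  Pr-uniform-≥ : ∀ {a} as → a ∈ as → T (E (g a)) → w ≤ℚ Pr (uniform g w as) E
  Pr-uniform-≥ {a} (a ∷ as) (here refl) Ega with E (g a)
  ... | true = ℚ.≤-trans (ℚ.≤-reflexive (sym (ℚ.+-identityʳ w))) (ℚ.+-monoʳ-≤ w (Pr-uniform-≥0 as))
  Pr-uniform-≥ (b ∷ as) (there a∈) Ega =
    ℚ.≤-trans (ℚ.≤-reflexive (sym (ℚ.+-identityˡ w))) (ℚ.+-mono-≤ (weight-≥0 (E (g b))) (Pr-uniform-≥ as a∈ Ega))

-- Reducibility from one witness per requirement

Reducible4-antitone : ∀ {n ξ ξ′} {G : Graph n} {VH} → ξ′ ≤ℚ ξ → Reducible4 ξ G VH → Reducible4 ξ′ G VH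
Reducible4-antitone ξ′≤ξ red L asg =
  let D , dist , fix , forb = red L asg
  in D , dist , (λ v c v∈ c∈ → ℚ.≤-trans ξ′≤ξ (fix v c v∈ c∈))
              , (λ u₁ u₂ c u₁∈ u₂∈ c∈ → ℚ.≤-trans ξ′≤ξ (forb u₁ u₂ c u₁∈ u₂∈ c∈))

record Witnesses {n} (G : Graph n) (VH : Fin n → Bool) (L : Fin n → List ℕ) : Set where
  field
    fix  : ∀ {v c} → T (VH v) → c ∈ L v → ∃[ φ ] IsLColoring G VH L φ × φ v ≡ c
    forb : ∀ {u₁ u₂} c → T (VH u₁) → T (VH u₂) → ∃[ φ ] IsLColoring G VH L φ × φ u₁ ≢ c × φ u₂ ≢ c

-- u, v are the hubs and r₁, r₂ the rims of the configuration.
data Slot : Set where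
  U V R₁ R₂ : Slot

slots : List Slot
slots = U ∷ V ∷ R₁ ∷ R₂ ∷ []

∈-slots : ∀ i → i ∈ slots
∈-slots U  = here refl
∈-slots V  = there (here refl)
∈-slots R₁ = there (there (here refl))
∈-slots R₂ = there (there (there (here refl)))

w₀ : ℚ
w₀ = ℤ.+ 1 / 272

0≤w₀ : 0ℚ ≤ℚ w₀
0≤w₀ = ℚ.nonNegative⁻¹ w₀

ξ₀≤w₀ : ξ₀ ≤ℚ w₀
ξ₀≤w₀ = toWitness {a? = ξ₀ ℚ.≤? w₀} tt

module FourVertices {n} (G : Graph n) (VH : Fin n → Bool) (vert : Slot → Fin n)
  (vert-in : ∀ i → T (VH (vert i))) (vert-onto : ∀ {y} → T (VH y) → ∃[ i ] y ≡ vert i) where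

  Request : Set
  Request = (Slot × Fin 4) ⊎ (Slot × Slot × Slot × Fin 4)

  fix-requests : List (Slot × Fin 4)
  fix-requests = cartesianProduct slots (allFin 4)

  forb-requests : List (Slot × Slot × Slot × Fin 4)
  forb-requests = cartesianProduct slots (cartesianProduct slots (cartesianProduct slots (allFin 4)))

  requests : List Request
  requests = map inj₁ fix-requests ++ map inj₂ forb-requests

  fix-request∈ : ∀ i p → inj₁ (i , p) ∈ requests
  fix-request∈ i p =
    ∈-++⁺ˡ {ys = map inj₂ forb-requests} (∈-map⁺ inj₁ (∈-cartesianProduct⁺ (∈-slots i) (∈-allFin p)))

  forb-request∈ : ∀ i j k p → inj₂ (i , j , k , p) ∈ requests
  forb-request∈ i j k p = ∈-++⁺ʳ (map inj₁ fix-requests) (∈-map⁺ inj₂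
    (∈-cartesianProduct⁺ (∈-slots i)
      (∈-cartesianProduct⁺ (∈-slots j) (∈-cartesianProduct⁺ (∈-slots k) (∈-allFin p)))))

  -- One request per slot and list position for (FIX), and one per pair of slots, slot holding the
  -- colour and position for (FORB): 4·4 + 4³·4 = 272.
  total-weight : length requests · w₀ ≡ 1ℚ
  total-weight = refl

  module _ (L : Fin n → List ℕ) (asg : IsAssignment G VH L) (W : Witnesses G VH L) where
    open Witnesses W

    Meets : Request → (Fin n → ℕ) → Set
    Meets (inj₁ (i , p))         φ = nth (L (vert i)) p ∈ L (vert i) → φ (vert i) ≡ nth (L (vert i)) p
    Meets (inj₂ (i , j , k , p)) φ = φ (vert i) ≢ nth (L (vert k)) p × φ (vert j) ≢ nth (L (vert k)) p

    -- A (FIX) request at a position past the end of the list asks for nothing.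
    fix-if-possible : ∀ i c → Dec (c ∈ L (vert i)) →
      ∃[ φ ] IsLColoring G VH L φ × (c ∈ L (vert i) → φ (vert i) ≡ c)
    fix-if-possible i c (yes c∈) = let φ , ok , φ≡c = fix (vert-in i) c∈ in φ , ok , λ _ → φ≡c
    fix-if-possible i c (no c∉)  = let φ , ok , _ = forb c (vert-in i) (vert-in i) in φ , ok , λ c∈ → ⊥-elim (c∉ c∈)

    answer : ∀ r → ∃[ φ ] IsLColoring G VH L φ × Meets r φ
    answer (inj₁ (i , p))         = fix-if-possible i _ (nth (L (vert i)) p ∈? L (vert i))
    answer (inj₂ (i , j , k , p)) = forb (nth (L (vert k)) p) (vert-in i) (vert-in j)

    distribution : Dist n
    distribution = uniform (proj₁ ∘ answer) w₀ requests

    is-distribution : IsDistOnLColorings G VH L distribution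
    is-distribution = All.map⁺ {xs = requests} (All.universal (λ r → 0≤w₀ , proj₁ (proj₂ (answer r))) requests) ,
                      trans (weightSum-uniform (proj₁ ∘ answer) w₀ requests) total-weight

    position : ∀ {c} i → c ∈ L (vert i) → ∃[ p ] nth {4} (L (vert i)) p ≡ c
    position i c∈ = nth-index _ c∈ (subst (_≤ 4) (sym (proj₂ (asg (vert i) (vert-in i)))) (ell≤4 G VH (vert i)))

    fixes-at : ∀ i {c} → c ∈ L (vert i) → w₀ ≤ℚ Pr distribution (λ φ → φ (vert i) ≡ᵇ c)
    fixes-at i {c} c∈ =
      let p , nth≡c = position i c∈
          φ≡ = proj₂ (proj₂ (answer (inj₁ (i , p)))) (subst (_∈ L (vert i)) (sym nth≡c) c∈)
      in Pr-uniform-≥ (proj₁ ∘ answer) 0≤w₀ (λ φ → φ (vert i) ≡ᵇ c) requests (fix-request∈ i p)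
           (≡⇒≡ᵇ _ _ (trans φ≡ nth≡c))

    fixes : FIX VH L w₀ distribution
    fixes v c v∈ = fixes-via (vert-onto v∈)
      where
      fixes-via : ∀ {y} → ∃[ i ] y ≡ vert i → c ∈ L y → w₀ ≤ℚ Pr distribution (λ φ → φ y ≡ᵇ c)
      fixes-via (i , refl) = fixes-at i

    forbids-at : ∀ i j k {c} → c ∈ L (vert k) →
      w₀ ≤ℚ Pr distribution (λ φ → not (φ (vert i) ≡ᵇ c) ∧ not (φ (vert j) ≡ᵇ c))
    forbids-at i j k {c} c∈ =
      let p , nth≡c = position k c∈
          φ , _ , avoid₁ , avoid₂ = answer (inj₂ (i , j , k , p))
      in Pr-uniform-≥ (proj₁ ∘ answer) 0≤w₀ (λ φ → not (φ (vert i) ≡ᵇ c) ∧ not (φ (vert j) ≡ᵇ c)) requests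
           (forb-request∈ i j k p)
           (T-∧-intro (≢⇒T-not-≡ᵇ (subst (φ (vert i) ≢_) nth≡c avoid₁))
                      (≢⇒T-not-≡ᵇ (subst (φ (vert j) ≢_) nth≡c avoid₂)))

    forbids : FORB VH L w₀ distribution
    forbids u₁ u₂ c u₁∈ u₂∈ = forbids-via (vert-onto u₁∈) (vert-onto u₂∈)
      where
      forbids-via : ∀ {y₁ y₂} → ∃[ i ] y₁ ≡ vert i → ∃[ j ] y₂ ≡ vert j → c ∈ L y₁ ⊎ c ∈ L y₂ →
        w₀ ≤ℚ Pr distribution (λ φ → not (φ y₁ ≡ᵇ c) ∧ not (φ y₂ ≡ᵇ c))
      forbids-via (i , refl) (j , refl) (inj₁ c∈i) = forbids-at i j i c∈i
      forbids-via (i , refl) (j , refl) (inj₂ c∈j) = forbids-at i j j c∈j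

  reducible : (∀ L → IsAssignment G VH L → Witnesses G VH L) → Reducible4 w₀ G VH
  reducible witnesses L asg = distribution L asg W , is-distribution L asg W , fixes L asg W , forbids L asg W
    where W = witnesses L asg

-- Colourings of the configuration

Colouring : Set
Colouring = Slot → ℕ

colouring : ℕ → ℕ → ℕ → ℕ → Colouring
colouring a b x y U  = a
colouring a b x y V  = b
colouring a b x y R₁ = x
colouring a b x y R₂ = y

-- κ properly Λ-colours the 4-cycle u r₁ v r₂, together with the chord uv if e and the chord r₁r₂ if f.
ListColouring : Bool → Bool → (Slot → List ℕ) → Colouring → Set
ListColouring e f Λ κ =
  (κ U ∈ Λ U × κ V ∈ Λ V × κ R₁ ∈ Λ R₁ × κ R₂ ∈ Λ R₂) ×
  (κ R₁ ≢ κ U × κ R₂ ≢ κ U × κ R₁ ≢ κ V × κ R₂ ≢ κ V) ×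
  (T e → κ V ≢ κ U) × (T f → κ R₂ ≢ κ R₁)

Fixing : Bool → Bool → (Slot → List ℕ) → Slot → ℕ → Set
Fixing e f Λ i c = Σ Colouring λ κ → ListColouring e f Λ κ × κ i ≡ c

Forbidding : Bool → Bool → (Slot → List ℕ) → Slot → Slot → ℕ → Set
Forbidding e f Λ i j c = Σ Colouring λ κ → ListColouring e f Λ κ × κ i ≢ c × κ j ≢ c

-- The (FIX) and (FORB) requirements up to the symmetries u ↔ v and r₁ ↔ r₂.
record QuadWitnesses (e f : Bool) (Λ : Slot → List ℕ) : Set where
  field
    fix-u   : ∀ {c} → c ∈ Λ U → Fixing e f Λ U c
    fix-r   : ∀ {c} → c ∈ Λ R₁ → Fixing e f Λ R₁ c
    forb-uv : ∀ c → Forbidding e f Λ U V c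
    forb-ur : ∀ c → Forbidding e f Λ U R₁ c
    forb-rr : ∀ c → Forbidding e f Λ R₁ R₂ c

-- ℓ_H on the configuration when u, v are 4-vertices and r₁, r₂ are 3-vertices of G.
size : Bool → Bool → Slot → ℕ
size e f U  = ind e + 2
size e f V  = ind e + 2
size e f R₁ = 3 + ind f
size e f R₂ = 3 + ind f

Solvable : Bool → Bool → Set
Solvable e f = ∀ Λ → (∀ i → Unique (Λ i)) → (∀ i → length (Λ i) ≡ size e f i) → QuadWitnesses e f Λ

module Symmetry (σ : Slot → Slot) (involutive : ∀ i → σ (σ i) ≡ i)
  (size-invariant : ∀ e f i → size e f (σ i) ≡ size e f i)
  (automorphism : ∀ e f Λ κ → ListColouring e f (Λ ∘ σ) κ → ListColouring e f Λ (κ ∘ σ)) where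

  fixing : ∀ {e f Λ i c} → Fixing e f (Λ ∘ σ) i c → Fixing e f Λ (σ i) c
  fixing {e} {f} {Λ} {i} (κ , ok , κi≡c) = κ ∘ σ , automorphism e f Λ κ ok , trans (cong κ (involutive i)) κi≡c

  forbidding : ∀ {e f Λ i j c} → Forbidding e f (Λ ∘ σ) i j c → Forbidding e f Λ (σ i) (σ j) c
  forbidding {e} {f} {Λ} {i} {j} (κ , ok , κi≢c , κj≢c) =
    κ ∘ σ , automorphism e f Λ κ ok , subst (_≢ _) (sym (cong κ (involutive i))) κi≢c
                                    , subst (_≢ _) (sym (cong κ (involutive j))) κj≢c

  sizes : ∀ {e f} {Λ : Slot → List ℕ} → (∀ i → length (Λ i) ≡ size e f i) → ∀ i → length (Λ (σ i)) ≡ size e f i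
  sizes {e} {f} sz i = trans (sz (σ i)) (size-invariant e f i)

  solvable : ∀ {e f Λ} → Solvable e f → (∀ i → Unique (Λ i)) → (∀ i → length (Λ i) ≡ size e f i) →
    QuadWitnesses e f (Λ ∘ σ)
  solvable {e} {f} {Λ} solve uniq sz = solve (Λ ∘ σ) (uniq ∘ σ) (sizes {e} {f} {Λ} sz)

swap-hubs : Slot → Slot
swap-hubs U = V
swap-hubs V = U
swap-hubs i = i

swap-rims : Slot → Slot
swap-rims R₁ = R₂
swap-rims R₂ = R₁
swap-rims i  = i

swap-hubs-involutive : ∀ i → swap-hubs (swap-hubs i) ≡ i
swap-hubs-involutive U  = refl
swap-hubs-involutive V  = refl
swap-hubs-involutive R₁ = refl
swap-hubs-involutive R₂ = refl

swap-rims-involutive : ∀ i → swap-rims (swap-rims i) ≡ i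
swap-rims-involutive U  = refl
swap-rims-involutive V  = refl
swap-rims-involutive R₁ = refl
swap-rims-involutive R₂ = refl

size-swap-hubs : ∀ e f i → size e f (swap-hubs i) ≡ size e f i
size-swap-hubs _ _ U  = refl
size-swap-hubs _ _ V  = refl
size-swap-hubs _ _ R₁ = refl
size-swap-hubs _ _ R₂ = refl

size-swap-rims : ∀ e f i → size e f (swap-rims i) ≡ size e f i
size-swap-rims _ _ U  = refl
size-swap-rims _ _ V  = refl
size-swap-rims _ _ R₁ = refl
size-swap-rims _ _ R₂ = refl

ListColouring-swap-hubs : ∀ e f Λ κ → ListColouring e f (Λ ∘ swap-hubs) κ → ListColouring e f Λ (κ ∘ swap-hubs)
ListColouring-swap-hubs e f Λ κ ((a∈ , b∈ , x∈ , y∈) , (xa , ya , xb , yb) , vu , r₂r₁) =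
  (b∈ , a∈ , x∈ , y∈) , (xb , yb , xa , ya) , ≢-sym ∘ vu , r₂r₁

ListColouring-swap-rims : ∀ e f Λ κ → ListColouring e f (Λ ∘ swap-rims) κ → ListColouring e f Λ (κ ∘ swap-rims)
ListColouring-swap-rims e f Λ κ ((a∈ , b∈ , x∈ , y∈) , (xa , ya , xb , yb) , vu , r₂r₁) =
  (a∈ , b∈ , y∈ , x∈) , (ya , xa , yb , xb) , vu , ≢-sym ∘ r₂r₁

module Hubs = Symmetry swap-hubs swap-hubs-involutive size-swap-hubs ListColouring-swap-hubs
module Rims = Symmetry swap-rims swap-rims-involutive size-swap-rims ListColouring-swap-rims

module AllRequests {e f} (solve : Solvable e f) {Λ : Slot → List ℕ}
  (uniq : ∀ i → Unique (Λ i)) (sz : ∀ i → length (Λ i) ≡ size e f i) where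
  open QuadWitnesses

  W : QuadWitnesses e f Λ
  W = solve Λ uniq sz

  Wh : QuadWitnesses e f (Λ ∘ swap-hubs)
  Wh = Hubs.solvable {Λ = Λ} solve uniq sz

  Wr : QuadWitnesses e f (Λ ∘ swap-rims)
  Wr = Rims.solvable {Λ = Λ} solve uniq sz

  Whr : QuadWitnesses e f (Λ ∘ swap-hubs ∘ swap-rims)
  Whr = Rims.solvable {Λ = Λ ∘ swap-hubs} solve (uniq ∘ swap-hubs) (Hubs.sizes {Λ = Λ} sz)

  fix : ∀ i {c} → c ∈ Λ i → Fixing e f Λ i c
  fix U  = fix-u W
  fix V  = Hubs.fixing {Λ = Λ} ∘ fix-u Wh
  fix R₁ = fix-r W
  fix R₂ = Rims.fixing {Λ = Λ} ∘ fix-r Wr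

  private
    flip : ∀ {i j c} → Forbidding e f Λ i j c → Forbidding e f Λ j i c
    flip (κ , ok , κi≢c , κj≢c) = κ , ok , κj≢c , κi≢c

    diagonal : ∀ {i j c} → Forbidding e f Λ i j c → Forbidding e f Λ i i c
    diagonal (κ , ok , κi≢c , _) = κ , ok , κi≢c , κi≢c

    forb-ur₂ : ∀ c → Forbidding e f Λ U R₂ c
    forb-ur₂ c = Rims.forbidding {Λ = Λ} (forb-ur Wr c)

    forb-vr₁ : ∀ c → Forbidding e f Λ V R₁ c
    forb-vr₁ c = Hubs.forbidding {Λ = Λ} (forb-ur Wh c)

    forb-vr₂ : ∀ c → Forbidding e f Λ V R₂ c
    forb-vr₂ c = Hubs.forbidding {Λ = Λ} (Rims.forbidding {Λ = Λ ∘ swap-hubs} (forb-ur Whr c))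

  forb : ∀ i j c → Forbidding e f Λ i j c
  forb U  V  c = forb-uv W c
  forb U  R₁ c = forb-ur W c
  forb U  R₂ c = forb-ur₂ c
  forb V  R₁ c = forb-vr₁ c
  forb V  R₂ c = forb-vr₂ c
  forb R₁ R₂ c = forb-rr W c
  forb V  U  c = flip (forb-uv W c)
  forb R₁ U  c = flip (forb-ur W c)
  forb R₂ U  c = flip (forb-ur₂ c)
  forb R₁ V  c = flip (forb-vr₁ c)
  forb R₂ V  c = flip (forb-vr₂ c)
  forb R₂ R₁ c = flip (forb-rr W c)
  forb U  U  c = diagonal (forb-uv W c)
  forb V  V  c = diagonal (flip (forb-uv W c))
  forb R₁ R₁ c = diagonal (forb-rr W c)
  forb R₂ R₂ c = diagonal (flip (forb-rr W c))

module Picking {e f} (Λ : Slot → List ℕ) (uniq : ∀ i → Unique (Λ i)) (sz : ∀ i → length (Λ i) ≡ size e f i) where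

  pick : ∀ i F → T (length F <ᵇ size e f i) → ∃[ x ] x ∈ Λ i × Avoids x F
  pick i = fresh (uniq i) (sz i)

  pick-beside : ∀ i F {w} (p : w ∈ F) → (w ∈ Λ i → w ∈ (F ─ p)) → T (length F <ᵇ suc (size e f i)) →
    ∃[ x ] x ∈ Λ i × Avoids x F
  pick-beside i = fresh-beside (uniq i) (sz i)

  too-many-in : ∀ i {ys} → Unique ys → ys ⊆ Λ i → T (size e f i <ᵇ length ys) → ⊥
  too-many-in i = too-many (uniq i) (sz i)

-- The three configurations without both chords

module NoChord (Λ : Slot → List ℕ) (uniq : ∀ i → Unique (Λ i)) (sz : ∀ i → length (Λ i) ≡ size false false i) where
  open Picking Λ uniq sz

  fix-u : ∀ {c} → c ∈ Λ U → Fixing false false Λ U c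
  fix-u {c} c∈ =
    let b , b∈ , _             = pick V [] tt
        x , x∈ , x≢c , x≢b , _ = pick R₁ (c ∷ b ∷ []) tt
        y , y∈ , y≢c , y≢b , _ = pick R₂ (c ∷ b ∷ []) tt
    in colouring c b x y , ((c∈ , b∈ , x∈ , y∈) , (x≢c , y≢c , x≢b , y≢b) , (λ ()) , (λ ())) , refl

  fix-r : ∀ {c} → c ∈ Λ R₁ → Fixing false false Λ R₁ c
  fix-r {c} c∈ =
    let a , a∈ , a≢c , _       = pick U (c ∷ []) tt
        b , b∈ , b≢c , _       = pick V (c ∷ []) tt
        y , y∈ , y≢a , y≢b , _ = pick R₂ (a ∷ b ∷ []) tt
    in colouring a b c y , ((a∈ , b∈ , c∈ , y∈) , (≢-sym a≢c , y≢a , ≢-sym b≢c , y≢b) , (λ ()) , (λ ())) , refl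

  forb-uv : ∀ c → Forbidding false false Λ U V c
  forb-uv c =
    let a , a∈ , a≢c , _       = pick U (c ∷ []) tt
        b , b∈ , b≢c , _       = pick V (c ∷ []) tt
        x , x∈ , x≢a , x≢b , _ = pick R₁ (a ∷ b ∷ []) tt
        y , y∈ , y≢a , y≢b , _ = pick R₂ (a ∷ b ∷ []) tt
    in colouring a b x y , ((a∈ , b∈ , x∈ , y∈) , (x≢a , y≢a , x≢b , y≢b) , (λ ()) , (λ ())) , a≢c , b≢c

  forb-ur : ∀ c → Forbidding false false Λ U R₁ c
  forb-ur c =
    let a , a∈ , a≢c , _       = pick U (c ∷ []) tt
        x , x∈ , x≢c , x≢a , _ = pick R₁ (c ∷ a ∷ []) tt
        b , b∈ , b≢x , _       = pick V (x ∷ []) tt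
        y , y∈ , y≢a , y≢b , _ = pick R₂ (a ∷ b ∷ []) tt
    in colouring a b x y , ((a∈ , b∈ , x∈ , y∈) , (x≢a , y≢a , ≢-sym b≢x , y≢b) , (λ ()) , (λ ())) , a≢c , x≢c

  rims-avoiding : ∀ {c a b x y} → a ∈ Λ U → b ∈ Λ V → x ∈ Λ R₁ → y ∈ Λ R₂ →
    Avoids x (c ∷ a ∷ b ∷ []) → Avoids y (c ∷ a ∷ b ∷ []) → Forbidding false false Λ R₁ R₂ c
  rims-avoiding {a = a} {b} {x} {y} a∈ b∈ x∈ y∈ (x≢c , x≢a , x≢b , _) (y≢c , y≢a , y≢b , _) =
    colouring a b x y , ((a∈ , b∈ , x∈ , y∈) , (x≢a , y≢a , x≢b , y≢b) , (λ ()) , (λ ())) , x≢c , y≢c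

  -- A rim list has three colours, so it lies inside {c, α, β} for at most one of the pairs
  -- (α, β) = (a, b), (a′, b′), (a, b′), any two of whose triples share at most two colours.
  -- Hence one of the three pairs leaves a colour other than c, α, β in both rim lists.
  three-pairs : ∀ {c a a′ b b′} → a ∈ Λ U → a′ ∈ Λ U → b ∈ Λ V → b′ ∈ Λ V → a ≢ a′ → b ≢ b′ →
    (∀ {z} → z ∈ Λ U → z ∉ Λ V) → Forbidding false false Λ R₁ R₂ c
  three-pairs {c} {a} {a′} {b} {b′} a∈ a′∈ b∈ b′∈ a≢a′ b≢b′ disjoint =
    choose (fresh-or-⊆ (Λ R₁) (c ∷ a ∷ b ∷ [])) (fresh-or-⊆ (Λ R₂) (c ∷ a ∷ b ∷ []))
           (fresh-or-⊆ (Λ R₁) (c ∷ a′ ∷ b′ ∷ [])) (fresh-or-⊆ (Λ R₂) (c ∷ a′ ∷ b′ ∷ []))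
           (fresh-or-⊆ (Λ R₁) (c ∷ a ∷ b′ ∷ [])) (fresh-or-⊆ (Λ R₂) (c ∷ a ∷ b′ ∷ []))
    where
    apart : ∀ {p q} → p ∈ Λ U → q ∈ Λ V → p ≢ q
    apart p∈ q∈ refl = disjoint p∈ q∈

    Option : Slot → ℕ → ℕ → Set
    Option i α β = (∃[ x ] x ∈ Λ i × Avoids x (c ∷ α ∷ β ∷ [])) ⊎ Λ i ⊆ c ∷ α ∷ β ∷ []

    choose : Option R₁ a b → Option R₂ a b → Option R₁ a′ b′ → Option R₂ a′ b′ →
             Option R₁ a b′ → Option R₂ a b′ →
      Forbidding false false Λ R₁ R₂ c
    choose (inj₁ (x , x∈ , x-ok)) (inj₁ (y , y∈ , y-ok)) _ _ _ _ = rims-avoiding a∈ b∈ x∈ y∈ x-ok y-ok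
    choose _ _ (inj₁ (x , x∈ , x-ok)) (inj₁ (y , y∈ , y-ok)) _ _ = rims-avoiding a′∈ b′∈ x∈ y∈ x-ok y-ok
    choose _ _ _ _ (inj₁ (x , x∈ , x-ok)) (inj₁ (y , y∈ , y-ok)) = rims-avoiding a∈ b′∈ x∈ y∈ x-ok y-ok
    choose (inj₂ s) _ (inj₂ t) _ _ _ =
      ⊥-elim (⊈-both-triples (uniq R₁) (sz R₁) (here refl) (a≢a′ , apart a∈ b′∈ , tt) s t)
    choose (inj₂ s) _ _ _ (inj₂ t) _ =
      ⊥-elim (⊈-both-triples (uniq R₁) (sz R₁) (there (here refl)) (≢-sym (apart a∈ b∈) , b≢b′ , tt) s t)
    choose _ _ (inj₂ s) _ (inj₂ t) _ =
      ⊥-elim (⊈-both-triples (uniq R₁) (sz R₁) (here refl) (≢-sym a≢a′ , apart a′∈ b′∈ , tt) s t)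
    choose _ (inj₂ s) _ (inj₂ t) _ _ =
      ⊥-elim (⊈-both-triples (uniq R₂) (sz R₂) (here refl) (a≢a′ , apart a∈ b′∈ , tt) s t)
    choose _ (inj₂ s) _ _ _ (inj₂ t) =
      ⊥-elim (⊈-both-triples (uniq R₂) (sz R₂) (there (here refl)) (≢-sym (apart a∈ b∈) , b≢b′ , tt) s t)
    choose _ _ _ (inj₂ s) _ (inj₂ t) =
      ⊥-elim (⊈-both-triples (uniq R₂) (sz R₂) (here refl) (≢-sym a≢a′ , apart a′∈ b′∈ , tt) s t)

  forb-rr : ∀ c → Forbidding false false Λ R₁ R₂ c
  forb-rr c with find-or-none (_∈? Λ V) (Λ U)
  ... | inj₁ (z , z∈u , z∈v) =
    let x , x∈ , x≢c , x≢z , _ = pick R₁ (c ∷ z ∷ []) tt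
        y , y∈ , y≢c , y≢z , _ = pick R₂ (c ∷ z ∷ []) tt
    in rims-avoiding z∈u z∈v x∈ y∈ (x≢c , x≢z , x≢z , tt) (y≢c , y≢z , y≢z , tt)
  ... | inj₂ disjoint =
    let a  , a∈  , _        = pick U [] tt
        a′ , a′∈ , a′≢a , _ = pick U (a ∷ []) tt
        b  , b∈  , _        = pick V [] tt
        b′ , b′∈ , b′≢b , _ = pick V (b ∷ []) tt
    in three-pairs a∈ a′∈ b∈ b′∈ (≢-sym a′≢a) (≢-sym b′≢b) disjoint

  witnesses : QuadWitnesses false false Λ
  witnesses = record { fix-u = fix-u ; fix-r = fix-r ; forb-uv = forb-uv ; forb-ur = forb-ur ; forb-rr = forb-rr }

module HubChord (Λ : Slot → List ℕ) (uniq : ∀ i → Unique (Λ i)) (sz : ∀ i → length (Λ i) ≡ size true false i) where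
  open Picking Λ uniq sz

  fix-u : ∀ {c} → c ∈ Λ U → Fixing true false Λ U c
  fix-u {c} c∈ =
    let b , b∈ , b≢c , _       = pick V (c ∷ []) tt
        x , x∈ , x≢c , x≢b , _ = pick R₁ (c ∷ b ∷ []) tt
        y , y∈ , y≢c , y≢b , _ = pick R₂ (c ∷ b ∷ []) tt
    in colouring c b x y , ((c∈ , b∈ , x∈ , y∈) , (x≢c , y≢c , x≢b , y≢b) , (λ _ → b≢c) , (λ ())) , refl

  fix-r : ∀ {c} → c ∈ Λ R₁ → Fixing true false Λ R₁ c
  fix-r {c} c∈ =
    let a , a∈ , a≢c , _       = pick U (c ∷ []) tt
        b , b∈ , b≢c , b≢a , _ = pick V (c ∷ a ∷ []) tt
        y , y∈ , y≢a , y≢b , _ = pick R₂ (a ∷ b ∷ []) tt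
    in colouring a b c y , ((a∈ , b∈ , c∈ , y∈) , (≢-sym a≢c , y≢a , ≢-sym b≢c , y≢b) , (λ _ → b≢a) , (λ ())) , refl

  forb-uv : ∀ c → Forbidding true false Λ U V c
  forb-uv c =
    let a , a∈ , a≢c , _       = pick U (c ∷ []) tt
        b , b∈ , b≢c , b≢a , _ = pick V (c ∷ a ∷ []) tt
        x , x∈ , x≢a , x≢b , _ = pick R₁ (a ∷ b ∷ []) tt
        y , y∈ , y≢a , y≢b , _ = pick R₂ (a ∷ b ∷ []) tt
    in colouring a b x y , ((a∈ , b∈ , x∈ , y∈) , (x≢a , y≢a , x≢b , y≢b) , (λ _ → b≢a) , (λ ())) , a≢c , b≢c

  forb-ur : ∀ c → Forbidding true false Λ U R₁ c
  forb-ur c =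
    let a , a∈ , a≢c , _       = pick U (c ∷ []) tt
        x , x∈ , x≢c , x≢a , _ = pick R₁ (c ∷ a ∷ []) tt
        b , b∈ , b≢a , b≢x , _ = pick V (a ∷ x ∷ []) tt
        y , y∈ , y≢a , y≢b , _ = pick R₂ (a ∷ b ∷ []) tt
    in colouring a b x y , ((a∈ , b∈ , x∈ , y∈) , (x≢a , y≢a , ≢-sym b≢x , y≢b) , (λ _ → b≢a) , (λ ())) , a≢c , x≢c

  -- v only has to avoid two colours, because one of x, y is not in its list.
  hubs-last : ∀ {c x y w} → x ∈ Λ R₁ → y ∈ Λ R₂ → x ≢ c → y ≢ c → w ∈ x ∷ y ∷ [] → w ∉ Λ V →
    Forbidding true false Λ R₁ R₂ c
  hubs-last {x = x} {y} x∈ y∈ x≢c y≢c w∈ w∉ =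
    let a , a∈ , a≢x , a≢y , _       = pick U (x ∷ y ∷ []) tt
        b , b∈ , b≢x , b≢y , b≢a , _ = pick-beside V (x ∷ y ∷ a ∷ []) (∈-++⁺ˡ w∈) (⊥-elim ∘ w∉) tt
    in colouring a b x y , ((a∈ , b∈ , x∈ , y∈) , (≢-sym a≢x , ≢-sym a≢y , ≢-sym b≢x , ≢-sym b≢y) , (λ _ → b≢a) , (λ ()))
       , x≢c , y≢c

  forb-rr : ∀ c → Forbidding true false Λ R₁ R₂ c
  forb-rr c with find-or-none (λ z → (z ∈? Λ R₂) ×-dec ¬? (z ℕ.≟ c)) (Λ R₁)
  ... | inj₁ (z , z∈₁ , z∈₂ , z≢c) =
    let a , a∈ , a≢z , _       = pick U (z ∷ []) tt
        b , b∈ , b≢z , b≢a , _ = pick V (z ∷ a ∷ []) tt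
    in colouring a b z z , ((a∈ , b∈ , z∈₁ , z∈₂) , (≢-sym a≢z , ≢-sym a≢z , ≢-sym b≢z , ≢-sym b≢z) , (λ _ → b≢a) , (λ ()))
       , z≢c , z≢c
  ... | inj₂ apart with fresh-or-⊆ (Λ R₁) (c ∷ Λ V) | fresh-or-⊆ (Λ R₂) (c ∷ Λ V)
  ...   | inj₁ (x , x∈ , x≢c , x∉V) | _ =
    let y , y∈ , y≢c , _ = pick R₂ (c ∷ []) tt
    in hubs-last x∈ y∈ x≢c y≢c (here refl) (Avoids⇒∉ _ x∉V)
  ...   | inj₂ _ | inj₁ (y , y∈ , y≢c , y∉V) =
    let x , x∈ , x≢c , _ = pick R₁ (c ∷ []) tt
    in hubs-last x∈ y∈ x≢c y≢c (there (here refl)) (Avoids⇒∉ _ y∉V)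
  ...   | inj₂ R₁⊆ | inj₂ R₂⊆ =
    -- two colours other than c from each rim list, all distinct and all in the 3-colour list of v
    let p₁ , p₁∈ , p₁≢c , _         = pick R₁ (c ∷ []) tt
        q₁ , q₁∈ , q₁≢c , q₁≢p₁ , _ = pick R₁ (c ∷ p₁ ∷ []) tt
        p₂ , p₂∈ , p₂≢c , _         = pick R₂ (c ∷ []) tt
        q₂ , q₂∈ , q₂≢c , q₂≢p₂ , _ = pick R₂ (c ∷ p₂ ∷ []) tt
    in ⊥-elim $ too-many-in V
         ((≢-sym q₁≢p₁ ∷ cross p₁∈ p₂∈ p₁≢c ∷ cross p₁∈ q₂∈ p₁≢c ∷ []) ∷
          (cross q₁∈ p₂∈ q₁≢c ∷ cross q₁∈ q₂∈ q₁≢c ∷ []) ∷ (≢-sym q₂≢p₂ ∷ []) ∷ [] ∷ [])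
         (λ { (here refl) → into-V R₁⊆ p₁∈ p₁≢c ; (there (here refl)) → into-V R₁⊆ q₁∈ q₁≢c
            ; (there (there (here refl))) → into-V R₂⊆ p₂∈ p₂≢c
            ; (there (there (there (here refl)))) → into-V R₂⊆ q₂∈ q₂≢c })
         tt
    where
    cross : ∀ {s t} → s ∈ Λ R₁ → t ∈ Λ R₂ → s ≢ c → s ≢ t
    cross s∈ t∈ s≢c refl = apart s∈ (t∈ , s≢c)

    into-V : ∀ {i s} → Λ i ⊆ c ∷ Λ V → s ∈ Λ i → s ≢ c → s ∈ Λ V
    into-V ⊆cV s∈ s≢c = Any.tail s≢c (⊆cV s∈)

  witnesses : QuadWitnesses true false Λ
  witnesses = record { fix-u = fix-u ; fix-r = fix-r ; forb-uv = forb-uv ; forb-ur = forb-ur ; forb-rr = forb-rr }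

module RimChord (Λ : Slot → List ℕ) (uniq : ∀ i → Unique (Λ i)) (sz : ∀ i → length (Λ i) ≡ size false true i) where
  open Picking Λ uniq sz

  fix-u : ∀ {c} → c ∈ Λ U → Fixing false true Λ U c
  fix-u {c} c∈ =
    let b , b∈ , _                   = pick V [] tt
        x , x∈ , x≢c , x≢b , _       = pick R₁ (c ∷ b ∷ []) tt
        y , y∈ , y≢c , y≢b , y≢x , _ = pick R₂ (c ∷ b ∷ x ∷ []) tt
    in colouring c b x y , ((c∈ , b∈ , x∈ , y∈) , (x≢c , y≢c , x≢b , y≢b) , (λ ()) , (λ _ → y≢x)) , refl

  fix-r : ∀ {c} → c ∈ Λ R₁ → Fixing false true Λ R₁ c
  fix-r {c} c∈ =
    let a , a∈ , a≢c , _             = pick U (c ∷ []) tt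
        b , b∈ , b≢c , _             = pick V (c ∷ []) tt
        y , y∈ , y≢a , y≢b , y≢c , _ = pick R₂ (a ∷ b ∷ c ∷ []) tt
    in colouring a b c y , ((a∈ , b∈ , c∈ , y∈) , (≢-sym a≢c , y≢a , ≢-sym b≢c , y≢b) , (λ ()) , (λ _ → y≢c)) , refl

  forb-uv : ∀ c → Forbidding false true Λ U V c
  forb-uv c =
    let a , a∈ , a≢c , _             = pick U (c ∷ []) tt
        b , b∈ , b≢c , _             = pick V (c ∷ []) tt
        x , x∈ , x≢a , x≢b , _       = pick R₁ (a ∷ b ∷ []) tt
        y , y∈ , y≢a , y≢b , y≢x , _ = pick R₂ (a ∷ b ∷ x ∷ []) tt
    in colouring a b x y , ((a∈ , b∈ , x∈ , y∈) , (x≢a , y≢a , x≢b , y≢b) , (λ ()) , (λ _ → y≢x)) , a≢c , b≢c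

  forb-ur : ∀ c → Forbidding false true Λ U R₁ c
  forb-ur c =
    let a , a∈ , a≢c , _             = pick U (c ∷ []) tt
        b , b∈ , _                   = pick V [] tt
        x , x∈ , x≢c , x≢a , x≢b , _ = pick R₁ (c ∷ a ∷ b ∷ []) tt
        y , y∈ , y≢a , y≢b , y≢x , _ = pick R₂ (a ∷ b ∷ x ∷ []) tt
    in colouring a b x y , ((a∈ , b∈ , x∈ , y∈) , (x≢a , y≢a , x≢b , y≢b) , (λ ()) , (λ _ → y≢x)) , a≢c , x≢c

  -- r₂ only has to avoid three colours, because c, a, b either repeat or one of them is not in its list.
  rims-last : ∀ {c a b w} → a ∈ Λ U → b ∈ Λ V →
    (p : w ∈ c ∷ a ∷ b ∷ []) → (w ∈ Λ R₂ → w ∈ (c ∷ a ∷ b ∷ [] ─ p)) → Forbidding false true Λ R₁ R₂ c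
  rims-last {c} {a} {b} a∈ b∈ p redundant =
    let x , x∈ , x≢c , x≢a , x≢b , _       = pick R₁ (c ∷ a ∷ b ∷ []) tt
        y , y∈ , y≢x , y≢c , y≢a , y≢b , _ = pick-beside R₂ (x ∷ c ∷ a ∷ b ∷ []) (there p) (there ∘ redundant) tt
    in colouring a b x y , ((a∈ , b∈ , x∈ , y∈) , (x≢a , y≢a , x≢b , y≢b) , (λ ()) , (λ _ → y≢x)) , x≢c , y≢c

  forb-rr : ∀ c → Forbidding false true Λ R₁ R₂ c
  forb-rr c with c ∈? Λ U | c ∈? Λ V | find-or-none (_∈? Λ V) (Λ U)
  ... | yes c∈u | _ | _ =
    let b , b∈ , _ = pick V [] tt in rims-last c∈u b∈ (there (here refl)) (λ _ → here refl)
  ... | no _ | yes c∈v | _ =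
    let a , a∈ , _ = pick U [] tt in rims-last a∈ c∈v (there (there (here refl))) (λ _ → here refl)
  ... | no _ | no _ | inj₁ (z , z∈u , z∈v) = rims-last z∈u z∈v (there (there (here refl))) (λ _ → there (here refl))
  ... | no c∉u | no c∉v | inj₂ disjoint with c ∈? Λ R₂ | fresh-or-⊆ (Λ U) (Λ R₂) | fresh-or-⊆ (Λ V) (Λ R₂)
  ...   | no c∉₂ | _ | _ =
    let a , a∈ , _ = pick U [] tt
        b , b∈ , _ = pick V [] tt
    in rims-last a∈ b∈ (here refl) (⊥-elim ∘ c∉₂)
  ...   | yes _ | inj₁ (a , a∈ , a∉₂) | _ =
    let b , b∈ , _ = pick V [] tt in rims-last a∈ b∈ (there (here refl)) (⊥-elim ∘ Avoids⇒∉ _ a∉₂)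
  ...   | yes _ | inj₂ _ | inj₁ (b , b∈ , b∉₂) =
    let a , a∈ , _ = pick U [] tt in rims-last a∈ b∈ (there (there (here refl))) (⊥-elim ∘ Avoids⇒∉ _ b∉₂)
  ...   | yes c∈₂ | inj₂ U⊆ | inj₂ V⊆ =
    -- c and the two colours of each hub list would be five distinct colours in the 4-colour list of r₂
    let a  , a∈  , _        = pick U [] tt
        a′ , a′∈ , a′≢a , _ = pick U (a ∷ []) tt
        b  , b∈  , _        = pick V [] tt
        b′ , b′∈ , b′≢b , _ = pick V (b ∷ []) tt
    in ⊥-elim $ too-many-in R₂
         ((outside c∉u a∈ ∷ outside c∉u a′∈ ∷ outside c∉v b∈ ∷ outside c∉v b′∈ ∷ []) ∷
          (≢-sym a′≢a ∷ apart a∈ b∈ ∷ apart a∈ b′∈ ∷ []) ∷ (apart a′∈ b∈ ∷ apart a′∈ b′∈ ∷ []) ∷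
          (≢-sym b′≢b ∷ []) ∷ [] ∷ [])
         (λ { (here refl) → c∈₂ ; (there (here refl)) → U⊆ a∈ ; (there (there (here refl))) → U⊆ a′∈
            ; (there (there (there (here refl)))) → V⊆ b∈ ; (there (there (there (there (here refl))))) → V⊆ b′∈ })
         tt
    where
    outside : ∀ {i s} → c ∉ Λ i → s ∈ Λ i → c ≢ s
    outside c∉ s∈ refl = c∉ s∈

    apart : ∀ {p q} → p ∈ Λ U → q ∈ Λ V → p ≢ q
    apart p∈ q∈ refl = disjoint p∈ q∈

  witnesses : QuadWitnesses false true Λ
  witnesses = record { fix-u = fix-u ; fix-r = fix-r ; forb-uv = forb-uv ; forb-ur = forb-ur ; forb-rr = forb-rr }

solvable : ∀ e f → ¬ (T e × T f) → Solvable e f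
solvable false false _ = NoChord.witnesses
solvable true  false _ = HubChord.witnesses
solvable false true  _ = RimChord.witnesses
solvable true  true  both-chords = ⊥-elim (both-chords (tt , tt))

-- The configuration inside G

module Quad {n} (G : Graph n) {u v r₁ r₂ : Fin n} (u≢v : u ≢ v) (r₁≢r₂ : r₁ ≢ r₂)
  (ur₁ : Adj G u r₁) (vr₁ : Adj G v r₁) (ur₂ : Adj G u r₂) (vr₂ : Adj G v r₂)
  (du : deg G u ≡ 4) (dv : deg G v ≡ 4) (d₁ : deg G r₁ ≡ 3) (d₂ : deg G r₂ ≡ 3) where

  open DecMembership (Fin._≟_ {n}) using () renaming (_∈?_ to _∈ⱽ?_)

  e f : Bool
  e = adj G u v
  f = adj G r₁ r₂

  vert : Slot → Fin n
  vert U  = u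
  vert V  = v
  vert R₁ = r₁
  vert R₂ = r₂

  members : List (Fin n)
  members = map vert slots

  members-unique : Unique members
  members-unique = (u≢v ∷ Adj-irrefl G ur₁ ∷ Adj-irrefl G ur₂ ∷ []) ∷ (Adj-irrefl G vr₁ ∷ Adj-irrefl G vr₂ ∷ []) ∷
                   (r₁≢r₂ ∷ []) ∷ [] ∷ []

  VH : Fin n → Bool
  VH y = does (y ∈ⱽ? members)

  vert-in : ∀ i → T (VH (vert i))
  vert-in i = does-complete (vert i ∈ⱽ? members) (∈-map⁺ vert (∈-slots i))

  vert-onto : ∀ {y} → T (VH y) → ∃[ i ] y ≡ vert i
  vert-onto {y} y∈ with does-sound (y ∈ⱽ? members) y∈
  ... | here y≡u                             = U  , y≡u
  ... | there (here y≡v)                     = V  , y≡v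
  ... | there (there (here y≡r₁))            = R₁ , y≡r₁
  ... | there (there (there (here y≡r₂)))    = R₂ , y≡r₂

  degH-members : ∀ x → degH G VH x ≡ ind (adj G x u) + (ind (adj G x v) + (ind (adj G x r₁) + (ind (adj G x r₂) + 0)))
  degH-members x = countIn-∧-∈ Fin._≟_ (adj G x) members members-unique (allFin n) (allFin⁺ n) (λ {y} _ → ∈-allFin y)

  ell-vert : ∀ i → ell G VH (vert i) ≡ size e f i
  ell-vert U rewrite degH-members u | du | irrefl G u | T⇒≡true ur₁ | T⇒≡true ur₂ = refl
  ell-vert V rewrite degH-members v | dv | Graph.sym G v u | irrefl G v | T⇒≡true vr₁ | T⇒≡true vr₂ = refl
  ell-vert R₁ rewrite degH-members r₁ | d₁ | T⇒≡true (Adj-sym G ur₁) | T⇒≡true (Adj-sym G vr₁) | irrefl G r₁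
    | +-identityʳ (ind f) = refl
  ell-vert R₂ rewrite degH-members r₂ | d₂ | T⇒≡true (Adj-sym G ur₂) | T⇒≡true (Adj-sym G vr₂) | Graph.sym G r₂ r₁
    | irrefl G r₂ | +-identityʳ (ind f) = refl

  slot-of : Fin n → Slot
  slot-of y = if does (y Fin.≟ u) then U else if does (y Fin.≟ v) then V else if does (y Fin.≟ r₁) then R₁ else R₂

  slot-of-vert : ∀ i → slot-of (vert i) ≡ i
  slot-of-vert U rewrite dec-true (u Fin.≟ u) refl = refl
  slot-of-vert V rewrite dec-false (v Fin.≟ u) (≢-sym u≢v) | dec-true (v Fin.≟ v) refl = refl
  slot-of-vert R₁ rewrite dec-false (r₁ Fin.≟ u) (≢-sym (Adj-irrefl G ur₁))
    | dec-false (r₁ Fin.≟ v) (≢-sym (Adj-irrefl G vr₁)) | dec-true (r₁ Fin.≟ r₁) refl = refl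
  slot-of-vert R₂ rewrite dec-false (r₂ Fin.≟ u) (≢-sym (Adj-irrefl G ur₂))
    | dec-false (r₂ Fin.≟ v) (≢-sym (Adj-irrefl G vr₂)) | dec-false (r₂ Fin.≟ r₁) (≢-sym r₁≢r₂) = refl

  lift : Colouring → Fin n → ℕ
  lift κ = κ ∘ slot-of

  lift-vert : ∀ κ i → lift κ (vert i) ≡ κ i
  lift-vert κ i = cong κ (slot-of-vert i)

  separated : ∀ {Λ κ} → ListColouring e f Λ κ → ∀ i j → Adj G (vert i) (vert j) → κ i ≢ κ j
  separated {κ = κ} (_ , (xa , ya , xb , yb) , vu , r₂r₁) = go
    where
    go : ∀ i j → Adj G (vert i) (vert j) → κ i ≢ κ j
    go U  V  uv   = ≢-sym (vu uv)
    go V  U  vu′  = vu (Adj-sym G vu′)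
    go R₁ R₂ r₁r₂ = ≢-sym (r₂r₁ r₁r₂)
    go R₂ R₁ r₂r₁′ = r₂r₁ (Adj-sym G r₂r₁′)
    go U  R₁ _ = ≢-sym xa
    go U  R₂ _ = ≢-sym ya
    go V  R₁ _ = ≢-sym xb
    go V  R₂ _ = ≢-sym yb
    go R₁ U  _ = xa
    go R₂ U  _ = ya
    go R₁ V  _ = xb
    go R₂ V  _ = yb
    go U  U  uu   = ⊥-elim (Adj-irrefl G uu refl)
    go V  V  vv   = ⊥-elim (Adj-irrefl G vv refl)
    go R₁ R₁ r₁r₁ = ⊥-elim (Adj-irrefl G r₁r₁ refl)
    go R₂ R₂ r₂r₂ = ⊥-elim (Adj-irrefl G r₂r₂ refl)

  lift-colouring : ∀ {L κ} → ListColouring e f (L ∘ vert) κ → IsLColoring G VH L (lift κ)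
  lift-colouring {L} {κ} ok@((a∈ , b∈ , x∈ , y∈) , _) =
    (λ y y∈ → in-list (vert-onto y∈)) , (λ y₁ y₂ y₁∈ y₂∈ → apart (vert-onto y₁∈) (vert-onto y₂∈))
    where
    member : ∀ i → κ i ∈ L (vert i)
    member U  = a∈
    member V  = b∈
    member R₁ = x∈
    member R₂ = y∈

    in-list : ∀ {y} → ∃[ i ] y ≡ vert i → lift κ y ∈ L y
    in-list (i , refl) = subst (_∈ L (vert i)) (sym (lift-vert κ i)) (member i)

    apart : ∀ {y₁ y₂} → ∃[ i ] y₁ ≡ vert i → ∃[ j ] y₂ ≡ vert j → Adj G y₁ y₂ → lift κ y₁ ≢ lift κ y₂
    apart (i , refl) (j , refl) adjacent rewrite lift-vert κ i | lift-vert κ j = separated {L ∘ vert} {κ} ok i j adjacent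

  witnesses : Solvable e f → ∀ L → IsAssignment G VH L → Witnesses G VH L
  witnesses solve L asg = record
    { fix  = λ v∈ → fixing (vert-onto v∈)
    ; forb = λ c u₁∈ u₂∈ → forbidding c (vert-onto u₁∈) (vert-onto u₂∈)
    }
    where
    open AllRequests solve {L ∘ vert} (λ i → proj₁ (asg (vert i) (vert-in i)))
                                      (λ i → trans (proj₂ (asg (vert i) (vert-in i))) (ell-vert i))

    fixing : ∀ {y c} → ∃[ i ] y ≡ vert i → c ∈ L y → ∃[ φ ] IsLColoring G VH L φ × φ y ≡ c
    fixing (i , refl) c∈ =
      let κ , ok , κi≡c = fix i c∈ in lift κ , lift-colouring {L} {κ} ok , trans (lift-vert κ i) κi≡c

    forbidding : ∀ {y₁ y₂} c → ∃[ i ] y₁ ≡ vert i → ∃[ j ] y₂ ≡ vert j →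
      ∃[ φ ] IsLColoring G VH L φ × φ y₁ ≢ c × φ y₂ ≢ c
    forbidding c (i , refl) (j , refl) =
      let κ , ok , κi≢c , κj≢c = forb i j c
      in lift κ , lift-colouring {L} {κ} ok , subst (_≢ c) (sym (lift-vert κ i)) κi≢c
                                           , subst (_≢ c) (sym (lift-vert κ j)) κj≢c

  reducible : Solvable e f → Reducible4 w₀ G VH
  reducible = FourVertices.reducible G VH vert vert-in vert-onto ∘ witnesses

special-degrees : ∀ {n} (G : Graph n) {a b c d} → deg G a ≡ 4 → deg G b ≡ 4 → deg G c ≡ 3 → deg G d ≡ 3 →
  countDeg G 3 (a ∷ b ∷ c ∷ d ∷ []) ≡ 2 × countDeg G 4 (a ∷ b ∷ c ∷ d ∷ []) ≡ 2
special-degrees G da db dc dd rewrite da | db | dc | dd = refl , refl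

lemma4p4 : ∀ {n} (G : Graph n) → NoReducible ξ₀ G →
    ∀ u v r₁ r₂ → u ≢ v → Stressed G u → Stressed G v →
    r₁ ≢ r₂ → Adj G u r₁ → Adj G v r₁ → Adj G u r₂ → Adj G v r₂ →
    deg G r₁ ≡ 3 → deg G r₂ ≡ 3 →
    SpecialK4 G u v r₁ r₂
lemma4p4 G no-reducible u v r₁ r₂ u≢v (du , _) (dv , _) r₁≢r₂ ur₁ vr₁ ur₂ vr₂ d₁ d₂ =
  by-chords (T? (adj G u v) ×-dec T? (adj G r₁ r₂))
  where
  open Quad G u≢v r₁≢r₂ ur₁ vr₁ ur₂ vr₂ du dv d₁ d₂

  by-chords : Dec (Adj G u v × Adj G r₁ r₂) → SpecialK4 G u v r₁ r₂
  by-chords (yes (uv , r₁r₂)) = (uv , ur₁ , ur₂ , vr₁ , vr₂ , r₁r₂) , special-degrees G du dv d₁ d₂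
  by-chords (no missing-chord) =
    ⊥-elim (no-reducible VH (u , vert-in U) (Reducible4-antitone {G = G} {VH} ξ₀≤w₀ (reducible (solvable e f missing-chord))))
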